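{- Let $S[1..n]$ be a string and let $\mathrm{LLRc}[1..m]$ be the array of all useful LLRs of $S$, each stored as a pair $(start,end)$ (the LLR is $S[start..end]$), sorted in ascending order of start position. Then for all $1\le i<j\le m$: $\mathrm{LLRc}[i].start<\mathrm{LLRc}[j].start$ and $\mathrm{LLRc}[i].end<\mathrm{LLRc}[j].end$.
   Context: $S[i..j]=S[i]\cdots S[j]$. A substring is unique if no other substring at a different start position equals it; a repeat is a non-unique substring. $\mathrm{LLR}_k$ (left-bounded longest repeat at $k$) is a repeat $S[k..j]$ such that either $j=n$ or $S[k..j+1]$ is unique; it does not exist if $S[k]$ is unique. An LLR is useless if it is a substring, in position terms, of another LLR (i.e. $S[k'..j']$ with $k\le k'\le j'\le j$ and $j'-k'<j-k$ for another LLR $S[k..j]$); otherwise it is useful. -}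

module Defs where

open import Data.Nat using (ℕ; zero; suc; _+_; _∸_; _≤_; _<_)
open import Data.Nat.Properties using (≤-<-trans)
open import Data.Fin using (Fin; fromℕ<)
open import Data.Product using (_×_; _,_; proj₁; proj₂; Σ; ∃; ∃-syntax)
open import Data.Sum using (_⊎_)
open import Relation.Nullary using (¬_)
open import Relation.Binary.PropositionalEquality using (_≡_; _≢_)

-- A string of length n over an arbitrary alphabet A: S[0], …, S[n-1].
-- Positions are 0-based here (the paper uses 1-based positions; the
-- statement is invariant under this shift).
Str : Set → ℕ → Set
Str A n = Fin n → A

char : ∀ {A n} → Str A n → (p : ℕ) → p < n → A
char S p p<n = S (fromℕ< p<n)

OccursAt : ∀ {A n} → Str A n → (i j p : ℕ) → Set
OccursAt {n = n} S i j p =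
  Σ (p + (j ∸ i) < n) λ pb →
  Σ (j < n) λ jb →
  (t : ℕ) (t≤ : t ≤ j ∸ i) (q1 : p + t < n) (q2 : i + t < n) →
    char S (p + t) q1 ≡ char S (i + t) q2

Repeat : ∀ {A n} → Str A n → (i j : ℕ) → Set
Repeat S i j = i ≤ j × ∃[ p ] (p ≢ i × OccursAt S i j p)

UniqueSub : ∀ {A n} → Str A n → (i j : ℕ) → Set
UniqueSub {n = n} S i j = i ≤ j × j < n × ¬ Repeat S i j

IsLLR : ∀ {A n} → Str A n → (k j : ℕ) → Set
IsLLR {n = n} S k j = Repeat S k j × (suc j ≡ n ⊎ UniqueSub S k (suc j))

Useless : ∀ {A n} → Str A n → (k' j' : ℕ) → Set
Useless S k' j' = IsLLR S k' j' ×
  ∃[ k ] ∃[ j ] (IsLLR S k j × k ≤ k' × j' ≤ j × j' ∸ k' < j ∸ k)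

Useful : ∀ {A n} → Str A n → (k j : ℕ) → Set
Useful S k j = IsLLR S k j × ¬ Useless S k j

-- The argument rests on two facts about LLRs.
--   * An LLR is determined by its start: if S[k..j] and S[k..j'] were both
--     LLRs with j < j', then S[k..j+1] would be a prefix of the repeat
--     S[k..j'], hence a repeat, contradicting the maximality of S[k..j].
--     So two distinct list entries have distinct starts, and sorted starts
--     are strictly increasing.
--   * Among useful LLRs, a strictly later start forces a strictly later
--     end: if k < k' and e' ≤ e then S[k'..e'] lies inside S[k..e] and is
--     strictly shorter, so S[k'..e'] would be useless.
module Submission where

open import Defs
open import Data.Nat using (ℕ; _≤_; _<_; suc; _∸_)
open import Data.Nat.Properties
  using (≤-trans; ≤-<-trans; m≤n⇒m≤1+n; +-monoʳ-≤; ∸-monoˡ-≤; ∸-monoʳ-<;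
         ≤-pred; ≤⇒≯; ≰⇒>; <⇒≤; ≤∧≢⇒<; <-cmp; _≤?_)
open import Data.Fin using (Fin) renaming (_<_ to _<ᶠ_; zero to fzero; suc to fsuc)
open import Data.Product using (_×_; _,_; proj₁; proj₂)
open import Data.Sum using (inj₁; inj₂)
open import Data.List using (List; length; lookup; _∷_)
open import Data.List.Membership.Propositional using (_∈_)
open import Data.List.Membership.Propositional.Properties using (∈-lookup)
open import Data.List.Relation.Unary.Unique.Propositional using (Unique)
open import Data.List.Relation.Unary.AllPairs using (_∷_)
import Data.List.Relation.Unary.All as All
open import Function.Bundles using (_⇔_; Equivalence)
open import Relation.Binary.PropositionalEquality using (_≡_; _≢_; refl; cong)
open import Relation.Binary.Definitions using (tri<; tri≈; tri>)
open import Relation.Nullary using (¬_; yes; no)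
open import Data.Empty using (⊥-elim)

lookup-distinct : {X : Set} (xs : List X) → Unique xs →
  (i j : Fin (length xs)) → i <ᶠ j → lookup xs i ≢ lookup xs j
lookup-distinct (x ∷ xs) (x∉xs ∷ _) fzero (fsuc j) _ = All.lookup x∉xs (∈-lookup j)
lookup-distinct (x ∷ xs) (_ ∷ u) (fsuc i) (fsuc j) i<j =
  lookup-distinct xs u i j (≤-pred i<j)

-- Every non-empty prefix of a repeat is a repeat: the same other occurrence
-- witnesses it.  Stated for the prefix S[k..j+1] of S[k..j'], the case used.
repeat-prefix : ∀ {A n} (S : Str A n) {k j j'} →
  k ≤ j → suc j ≤ j' → Repeat S k j' → Repeat S k (suc j)
repeat-prefix S {k} {j} {j'} k≤j sj≤j' (_ , p , p≢k , p-bound , j'-bound , agree) =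
  m≤n⇒m≤1+n k≤j , p , p≢k ,
  ≤-<-trans (+-monoʳ-≤ p shorter) p-bound ,
  ≤-<-trans sj≤j' j'-bound ,
  λ t t≤ → agree t (≤-trans t≤ shorter)
  where
  shorter : suc j ∸ k ≤ j' ∸ k
  shorter = ∸-monoˡ-≤ k sj≤j'

llr-not-extendable : ∀ {A n} (S : Str A n) {k j j'} →
  IsLLR S k j → IsLLR S k j' → ¬ (j < j')
llr-not-extendable S (_ , inj₁ refl) ((_ , _ , _ , _ , j'-bound , _) , _) j<j' =
  ≤⇒≯ (≤-pred j'-bound) j<j'
llr-not-extendable S ((k≤j , _) , inj₂ (_ , _ , not-repeat)) (repeat' , _) j<j' =
  not-repeat (repeat-prefix S k≤j j<j' repeat')

llr-end-unique : ∀ {A n} (S : Str A n) {k j j'} →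
  IsLLR S k j → IsLLR S k j' → j ≡ j'
llr-end-unique S {j = j} {j'} llr llr' with <-cmp j j'
... | tri< j<j' _ _ = ⊥-elim (llr-not-extendable S llr llr' j<j')
... | tri≈ _ j≡j' _ = j≡j'
... | tri> _ _ j'<j = ⊥-elim (llr-not-extendable S llr' llr j'<j)

-- Of two useful LLRs, the one starting strictly later also ends strictly
-- later: otherwise it would sit strictly inside the other, making it useless.
useful-end-increasing : ∀ {A n} (S : Str A n) {k e k' e'} →
  Useful S k e → Useful S k' e' → k < k' → e < e'
useful-end-increasing S {k} {e} {k'} {e'} (llr , _) (llr' , useful') k<k' with e' ≤? e
... | no e'≰e = ≰⇒> e'≰e
... | yes e'≤e = ⊥-elim (useful' (llr' , k , e , llr , <⇒≤ k<k' , e'≤e , shorter))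
  where
  k'≤e' : k' ≤ e'
  k'≤e' = proj₁ (proj₁ llr')
  shorter : e' ∸ k' < e ∸ k
  shorter = ≤-<-trans (∸-monoˡ-≤ k' e'≤e) (∸-monoʳ-< k<k' (≤-trans k'≤e' e'≤e))

useful-start-determines : ∀ {A n} (S : Str A n) (x y : ℕ × ℕ) →
  Useful S (proj₁ x) (proj₂ x) → Useful S (proj₁ y) (proj₂ y) →
  proj₁ x ≡ proj₁ y → x ≡ y
useful-start-determines S (k , e) (.k , e') (llr , _) (llr' , _) refl =
  cong (k ,_) (llr-end-unique S llr llr')

fact1 : {A : Set} (n : ℕ) (S : Str A n) (LLRc : List (ℕ × ℕ)) →
    (∀ k j → ((k , j) ∈ LLRc) ⇔ Useful S k j) →
    Unique LLRc →
    (∀ (i j : Fin (length LLRc)) → i <ᶠ j →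
      proj₁ (lookup LLRc i) ≤ proj₁ (lookup LLRc j)) →
    ∀ (i j : Fin (length LLRc)) → i <ᶠ j →
      (proj₁ (lookup LLRc i) < proj₁ (lookup LLRc j))
      × (proj₂ (lookup LLRc i) < proj₂ (lookup LLRc j))
fact1 n S LLRc members unique sorted i j i<j = start-increases , end-increases
  where
  useful-entry : ∀ x → Useful S (proj₁ (lookup LLRc x)) (proj₂ (lookup LLRc x))
  useful-entry x = Equivalence.to (members _ _) (∈-lookup x)

  start-increases : proj₁ (lookup LLRc i) < proj₁ (lookup LLRc j)
  start-increases = ≤∧≢⇒< (sorted i j i<j) λ same-start →
    lookup-distinct LLRc unique i j i<j
      (useful-start-determines S _ _ (useful-entry i) (useful-entry j) same-start)

  end-increases : proj₂ (lookup LLRc i) < proj₂ (lookup LLRc j)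
  end-increases = useful-end-increasing S (useful-entry i) (useful-entry j) start-increases
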